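{- Suppose $N>2$ and $G$ is an $(N-2)$-undetermined impartial game. Then $\lfloor N/2+2\rfloor\cdot G$ is an absorbing game, i.e. $\lfloor N/2+2\rfloor\cdot G+H$ is undetermined for every impartial game $H$.
   Context: All games are short impartial games (identified with the finite set of their options, no infinite runs); $+$ is the disjunctive sum and $n\cdot G$ the sum of $n$ copies of $G$. There are $N$ players moving cyclically; under normal play the player unable to move on their turn is the unique loser. Relative to a position the players are $\mathbf N=\mathbf O_0,\mathbf O_1,\dots,\mathbf O_{N-2},\mathbf P=\mathbf O_{N-1}$ ($\mathbf O_i$ moves $i$ turns after $\mathbf N$), and the outcome $o(G)$ is defined recursively: $\mathbf N\in o(G)$ iff some option $G'$ has $\mathbf P\in o(G')$; for $1\le i\le N-1$, $\mathbf O_i\in o(G)$ iff every option $G'$ has $\mathbf O_{i-1}\in o(G')$. A game is undetermined if $o(G)=\emptyset$. $G$ is $1$-undetermined if it is undetermined; for $k>1$, $G$ is $k$-undetermined if it is undetermined and has an option that is $(k-1)$-undetermined (equivalently, there is a path of $k$ positions $G=J_0,J_1,\dots,J_{k-1}$, each an option of the previous, all undetermined). -}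

module Defs where

open import Data.Nat using (ℕ; zero; suc; _+_; _∸_; _<_)
open import Data.Fin using (Fin; splitAt)
open import Data.Sum using (_⊎_; [_,_]′)
open import Data.Product using (Σ; _×_)
open import Data.Unit using (⊤)
open import Data.Empty using (⊥)
open import Relation.Nullary using (¬_)

data Game : Set where
  mk : (n : ℕ) → (Fin n → Game) → Game

zeroG : Game
zeroG = mk 0 (λ ())

-- Disjunctive sum: options of G + H are G' + H and G + H'.
infixl 6 _⊕_
_⊕_ : Game → Game → Game
mk m f ⊕ mk n g =
  mk (m + n) (λ i → [ (λ a → f a ⊕ mk n g) , (λ b → mk m f ⊕ g b) ]′ (splitAt m i))

infixr 7 _·_
_·_ : ℕ → Game → Game
zero · G = zeroG
suc n · G = G ⊕ (n · G)

-- With N players, index i (0 ≤ i ≤ N-1) stands for player O_i;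
-- O_0 = N (next player), O_{N-1} = P (previous player).
-- InOutcome N G i  means  O_i ∈ o(G).
InOutcome : ℕ → Game → ℕ → Set
InOutcome N (mk n f) zero    = Σ (Fin n) (λ j → InOutcome N (f j) (N ∸ 1))
InOutcome N (mk n f) (suc i) = (j : Fin n) → InOutcome N (f j) i

Undetermined : ℕ → Game → Set
Undetermined N G = (i : ℕ) → i < N → ¬ InOutcome N G i

-- k-undetermined (k ≥ 1); the case k = 0 is an unused convention (trivially true).
KUndetermined : ℕ → ℕ → Game → Set
KUndetermined N zero G = ⊤
KUndetermined N (suc zero) G = Undetermined N G
KUndetermined N (suc (suc k)) (mk n f) =
  Undetermined N (mk n f) × Σ (Fin n) (λ j → KUndetermined N (suc k) (f j))

Absorbing : ℕ → Game → Set
Absorbing N G = (H : Game) → Undetermined N (G ⊕ H)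

module Submission where

-- We prove more: with N = M + 1 players the sum
-- of ANY two undetermined games is absorbing, hence so is m · G for every
-- undetermined G and every m ≥ 2 (an (N-2)-undetermined game is undetermined).
--
-- The tool is  Excluded G i , a positive, constructive form of "O_i ∉ o(G)"
-- defined by the same recursion as the outcome but for every i ∈ ℕ.  Since
-- outcomes are decidable it agrees with ¬ InOutcome on all indices.  Then:
--  (1) additivity: if X excludes O_a and Y excludes O_b, X + Y excludes O_(a+b);
--  (2) every game excludes some O_s with s ≤ M;
--  (3) complement: if Y is undetermined, Y + W excludes P = O_M for every W
--      (apply (1) with Y excluding O_(M-s), where W excludes O_s by (2));
--  (4) regrouping: Excluded is invariant under X+(Y+Z) ↦ (X+Y)+Z and
--      Y+(X+Z) ↦ (X+Y)+Z, because these pairs form a bisimulation;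
--  (5) absorption: every option of (X+Y)+H is covered by (3) after (4), so
--      P is excluded; O_(i+1) is excluded by moving in H, or by (1) if H has no move.

open import Defs
open import Data.Nat using (ℕ; zero; suc; _+_; _∸_; _<_; _≤_; _/_; z≤n; s≤s)
open import Data.Nat.Properties using (+-identityʳ; m∸n+n≡m; m∸n≤m; m≤n+m; <⇒≤; ≤∧≢⇒<)
open import Data.Fin using (Fin; zero; suc; splitAt; _↑ˡ_; _↑ʳ_)
open import Data.Fin.Properties using (splitAt-↑ˡ; splitAt-↑ʳ; all?; any?; ¬∀⟶∃¬)
open import Data.Sum using (inj₁; inj₂; [_,_]′)
open import Data.Product using (Σ; _×_; _,_)
open import Relation.Nullary using (¬_; Dec; yes; no)
open import Relation.Binary.PropositionalEquality using (_≡_; refl; cong; subst)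

Opt : Game → Game → Set
Opt (mk n f) G' = Σ (Fin n) (λ j → f j ≡ G')

optL : ∀ X Y {X'} → Opt X X' → Opt (X ⊕ Y) (X' ⊕ Y)
optL (mk m f) (mk n g) (a , refl) = a ↑ˡ n , cong [ _ , _ ]′ (splitAt-↑ˡ m a n)

optR : ∀ X Y {Y'} → Opt Y Y' → Opt (X ⊕ Y) (X ⊕ Y')
optR (mk m f) (mk n g) (b , refl) = m ↑ʳ b , cong [ _ , _ ]′ (splitAt-↑ʳ m n b)

data SumOption (X Y : Game) : Game → Set where
  left  : ∀ {X'} → Opt X X' → SumOption X Y (X' ⊕ Y)
  right : ∀ {Y'} → Opt Y Y' → SumOption X Y (X ⊕ Y')

sumOption : ∀ X Y {W} → Opt (X ⊕ Y) W → SumOption X Y W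
sumOption (mk m f) (mk n g) (j , refl) with splitAt m j
... | inj₁ a = left (a , refl)
... | inj₂ b = right (b , refl)

every-sum-option : ∀ (P : Game → Set) m f n g →
  (∀ a → P (f a ⊕ mk n g)) → (∀ b → P (mk m f ⊕ g b)) →
  ∀ {W} → Opt (mk m f ⊕ mk n g) W → P W
every-sum-option P m f n g left-moves right-moves o with sumOption (mk m f) (mk n g) o
... | left (a , refl)  = left-moves a
... | right (b , refl) = right-moves b

-- The parameter M fixes the number of players N = M + 1; P is O_M.
module Players (M : ℕ) where

  N : ℕ
  N = suc M

  -- The clause
  -- is used for all i, also beyond M, which is what makes it additive.
  Excluded : Game → ℕ → Set
  Excluded (mk n f) zero    = (j : Fin n) → Excluded (f j) M
  Excluded (mk n f) (suc i) = Σ (Fin n) (λ j → Excluded (f j) i)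

  excluded-zero-intro : ∀ G → (∀ {G'} → Opt G G' → Excluded G' M) → Excluded G 0
  excluded-zero-intro (mk n f) all = λ j → all (j , refl)

  excluded-suc-intro : ∀ G {G' i} → Opt G G' → Excluded G' i → Excluded G (suc i)
  excluded-suc-intro (mk n f) (j , refl) ex = j , ex

  excluded⇒∉ : ∀ G i → Excluded G i → ¬ InOutcome N G i
  excluded⇒∉ (mk n f) zero    ex      (j , io) = excluded⇒∉ (f j) M (ex j) io
  excluded⇒∉ (mk n f) (suc i) (j , ex) io      = excluded⇒∉ (f j) i ex (io j)

  -- Outcomes of short games are decidable, so the converse holds as well.
  inOutcome? : ∀ G i → Dec (InOutcome N G i)
  inOutcome? (mk n f) zero    = any? (λ j → inOutcome? (f j) M)
  inOutcome? (mk n f) (suc i) = all? (λ j → inOutcome? (f j) i)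

  ∉⇒excluded : ∀ G i → ¬ InOutcome N G i → Excluded G i
  ∉⇒excluded (mk n f) zero ∉ j = ∉⇒excluded (f j) M (λ io → ∉ (j , io))
  ∉⇒excluded (mk n f) (suc i) ∉
    with ¬∀⟶∃¬ n (λ j → InOutcome N (f j) i) (λ j → inOutcome? (f j) i) ∉
  ... | j , ∉j = j , ∉⇒excluded (f j) i ∉j

  excluded? : ∀ G i → Dec (Excluded G i)
  excluded? G i with inOutcome? G i
  ... | yes io = no (λ ex → excluded⇒∉ G i ex io)
  ... | no ∉   = yes (∉⇒excluded G i ∉)

  excluded-sum : ∀ X Y a b → Excluded X a → Excluded Y b → Excluded (X ⊕ Y) (a + b)
  excluded-sum (mk m f) Y (suc a) b (j , exX) exY =
    excluded-suc-intro (mk m f ⊕ Y) (optL (mk m f) Y (j , refl)) (excluded-sum (f j) Y a b exX exY)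
  excluded-sum X (mk n g) zero (suc b) exX (j , exY) =
    excluded-suc-intro (X ⊕ mk n g) (optR X (mk n g) (j , refl)) (excluded-sum X (g j) zero b exX exY)
  excluded-sum (mk m f) (mk n g) zero zero exX exY =
    excluded-zero-intro (mk m f ⊕ mk n g)
      (every-sum-option (λ W → Excluded W M) m f n g
        (λ a → subst (Excluded (f a ⊕ mk n g)) (+-identityʳ M) (excluded-sum (f a) (mk n g) M 0 (exX a) exY))
        (λ b → excluded-sum (mk m f) (g b) 0 M exX (exY b)))

  some-excluded : ∀ G → Σ ℕ (λ s → s ≤ M × Excluded G s)
  some-excluded (mk n f) with all? (λ j → excluded? (f j) M)
  ... | yes all = 0 , z≤n , all
  ... | no ¬all with ¬∀⟶∃¬ n (λ j → Excluded (f j) M) (λ j → excluded? (f j) M) ¬all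
  ...   | j , ¬exM with some-excluded (f j)
  ...     | s , s≤M , ex = suc s , ≤∧≢⇒< s≤M (λ s≡M → ¬exM (subst (Excluded (f j)) s≡M ex)) , (j , ex)

  AllExcluded : Game → Set
  AllExcluded G = ∀ i → i < N → Excluded G i

  undetermined⇒allExcluded : ∀ G → Undetermined N G → AllExcluded G
  undetermined⇒allExcluded G u i i<N = ∉⇒excluded G i (u i i<N)

  allExcluded⇒undetermined : ∀ G → AllExcluded G → Undetermined N G
  allExcluded⇒undetermined G ae i i<N = excluded⇒∉ G i (ae i i<N)

  complement : ∀ Y → AllExcluded Y → ∀ W → Excluded (Y ⊕ W) M
  complement Y aeY W with some-excluded W
  ... | s , s≤M , exW = subst (Excluded (Y ⊕ W)) (m∸n+n≡m s≤M)
                          (excluded-sum Y W (M ∸ s) s (aeY (M ∸ s) (s≤s (m∸n≤m M s))) exW)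

  Simulates : (Game → Game → Set) → Set
  Simulates R = ∀ {G H G'} → R G H → Opt G G' → Σ Game (λ H' → Opt H H' × R G' H')

  IsBisimulation : (Game → Game → Set) → Set
  IsBisimulation R = Simulates R × Simulates (λ H G → R G H)

  excluded-transport : ∀ {R} → IsBisimulation R → ∀ G H i → R G H → Excluded G i → Excluded H i
  excluded-transport (fwd , bwd) (mk m f) (mk n g) zero r ex k with bwd r (k , refl)
  ... | _ , (j , refl) , r' = excluded-transport (fwd , bwd) (f j) (g k) M r' (ex j)
  excluded-transport (fwd , bwd) (mk m f) (mk n g) (suc i) r (j , ex) with fwd r (j , refl)
  ... | _ , (k , refl) , r' = k , excluded-transport (fwd , bwd) (f j) (g k) i r' ex

  data Regrouped : Game → Game → Set where
    assoc    : ∀ X Y Z → Regrouped (X ⊕ (Y ⊕ Z)) ((X ⊕ Y) ⊕ Z)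
    exchange : ∀ X Y Z → Regrouped (Y ⊕ (X ⊕ Z)) ((X ⊕ Y) ⊕ Z)

  regrouped-forward : Simulates Regrouped
  regrouped-forward (assoc X Y Z) o with sumOption X (Y ⊕ Z) o
  ... | left p = _ , optL (X ⊕ Y) Z (optL X Y p) , assoc _ Y Z
  ... | right p with sumOption Y Z p
  ...   | left q  = _ , optL (X ⊕ Y) Z (optR X Y q) , assoc X _ Z
  ...   | right q = _ , optR (X ⊕ Y) Z q , assoc X Y _
  regrouped-forward (exchange X Y Z) o with sumOption Y (X ⊕ Z) o
  ... | left p = _ , optL (X ⊕ Y) Z (optR X Y p) , exchange X _ Z
  ... | right p with sumOption X Z p
  ...   | left q  = _ , optL (X ⊕ Y) Z (optL X Y q) , exchange _ Y Z
  ...   | right q = _ , optR (X ⊕ Y) Z q , exchange X Y _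

  regrouped-backward : Simulates (λ H G → Regrouped G H)
  regrouped-backward (assoc X Y Z) o with sumOption (X ⊕ Y) Z o
  ... | right p = _ , optR X (Y ⊕ Z) (optR Y Z p) , assoc X Y _
  ... | left p with sumOption X Y p
  ...   | left q  = _ , optL X (Y ⊕ Z) q , assoc _ Y Z
  ...   | right q = _ , optR X (Y ⊕ Z) (optL Y Z q) , assoc X _ Z
  regrouped-backward (exchange X Y Z) o with sumOption (X ⊕ Y) Z o
  ... | right p = _ , optR Y (X ⊕ Z) (optR X Z p) , exchange X Y _
  ... | left p with sumOption X Y p
  ...   | left q  = _ , optR Y (X ⊕ Z) (optL X Z q) , exchange _ Y Z
  ...   | right q = _ , optL Y (X ⊕ Z) q , exchange X _ Z

  regroup : ∀ {G H} i → Regrouped G H → Excluded G i → Excluded H i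
  regroup {G} {H} i = excluded-transport (regrouped-forward , regrouped-backward) G H i

  sum-absorbs : ∀ X Y → AllExcluded X → AllExcluded Y → ∀ H i → i < N → Excluded ((X ⊕ Y) ⊕ H) i
  sum-absorbs X Y aeX aeY H zero _ = excluded-zero-intro ((X ⊕ Y) ⊕ H) move
    where
    move : ∀ {W} → Opt ((X ⊕ Y) ⊕ H) W → Excluded W M
    move o with sumOption (X ⊕ Y) H o
    ... | right {H'} _ = regroup M (assoc X Y H') (complement X aeX (Y ⊕ H'))
    ... | left p with sumOption X Y p
    ...   | left {X'} _  = regroup M (exchange X' Y H) (complement Y aeY (X' ⊕ H))
    ...   | right {Y'} _ = regroup M (assoc X Y' H) (complement X aeX (Y' ⊕ H))
  sum-absorbs X Y aeX aeY (mk zero h) (suc i) i<N =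
    subst (Excluded ((X ⊕ Y) ⊕ mk zero h)) (+-identityʳ (suc i))
      (regroup (suc i + 0) (assoc X Y (mk zero h))
        (excluded-sum X (Y ⊕ mk zero h) (suc i) 0 (aeX (suc i) i<N)
          (excluded-sum Y (mk zero h) 0 0 (aeY 0 (s≤s z≤n)) (λ ()))))
  sum-absorbs X Y aeX aeY (mk (suc p) h) (suc i) i<N =
    excluded-suc-intro ((X ⊕ Y) ⊕ mk (suc p) h) (optR (X ⊕ Y) (mk (suc p) h) (zero , refl))
      (sum-absorbs X Y aeX aeY (h zero) i (<⇒≤ i<N))

  multiple-absorbing : ∀ G → AllExcluded G → ∀ m → 2 ≤ m → Absorbing N (m · G)
  multiple-absorbing G aeG (suc zero) (s≤s ())
  multiple-absorbing G aeG (suc (suc q)) _ H =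
    allExcluded⇒undetermined ((G ⊕ (suc q · G)) ⊕ H)
      (sum-absorbs G (suc q · G) aeG copies-undetermined H)
    where
    -- Every move in q · G is a move in one copy of G, which leaves P excluded.
    copies-exclude-next : ∀ q → Excluded (q · G) 0
    copies-exclude-next zero    = λ ()
    copies-exclude-next (suc q) = excluded-sum G (q · G) 0 0 (aeG 0 (s≤s z≤n)) (copies-exclude-next q)

    copies-undetermined : AllExcluded (suc q · G)
    copies-undetermined i i<N =
      subst (Excluded (suc q · G)) (+-identityʳ i) (excluded-sum G (q · G) i 0 (aeG i i<N) (copies-exclude-next q))

kUndetermined⇒undetermined : ∀ N k G → KUndetermined N (suc k) G → Undetermined N G
kUndetermined⇒undetermined N zero    G        u       = u
kUndetermined⇒undetermined N (suc k) (mk n f) (u , _) = u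

mainTheorem11 : (N : ℕ) → 2 < N → (G : Game) → KUndetermined N (N ∸ 2) G →
    Absorbing N ((N / 2 + 2) · G)
mainTheorem11 (suc (suc (suc k))) (s≤s (s≤s (s≤s z≤n))) G ku =
  multiple-absorbing G allExcluded (suc (suc (suc k)) / 2 + 2) (m≤n+m 2 (suc (suc (suc k)) / 2))
  where
  open Players (suc (suc k))
  allExcluded : AllExcluded G
  allExcluded = undetermined⇒allExcluded G (kUndetermined⇒undetermined N k G ku)
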